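{- Let $(P_0,P_1)$ be an equitable $2$-partition of the halved $n$-cube $\frac12 H(n)$ with quotient matrix $\begin{pmatrix} a & b\\ c & d\end{pmatrix}$, and suppose that $P_1$ is partitioned into $s$-faces, where $s=\sqrt{2d+n-2b}$. Then there exists an equitable $2$-partition of $\frac12 H(2n)$ with quotient matrix $\begin{pmatrix} 4a+n+2b & 2b\\ 4c+2b & 4d+n-2b\end{pmatrix}$.
   Context: The halved $m$-cube $\frac12 H(m)$ is the graph on the binary words of length $m$ with an even number of ones, two words adjacent iff they differ in exactly two positions. An $s$-face of $\frac12 H(n)$ is the set of $2^{s-1}$ vertices having prescribed values in some $n-s$ fixed coordinates (the other $s$ coordinates being free). An equitable $2$-partition is an ordered partition $(C_0,C_1)$ of the vertex set such that the number of neighbors in $C_j$ of any vertex of $C_i$ is a constant $S_{ij}$; $S=(S_{ij})$ is the quotient matrix. -}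

module Defs where

open import Data.Nat using (ℕ; zero; suc; _+_; _*_; _%_; _≡ᵇ_)
open import Data.Bool using (Bool; true; false; _∧_; _xor_; if_then_else_; not)
import Data.Fin as Fin
open Fin using (Fin)
open import Data.Fin.Properties using () renaming (_≟_ to _≟ᶠ_)
open import Data.Vec using (Vec; []; _∷_; zipWith; lookup)
open import Data.List using (List; []; _∷_; map; _++_; filter; length)
open import Data.Product using (Σ; ∃; _×_; _,_)
open import Relation.Binary.PropositionalEquality using (_≡_)
open import Relation.Nullary.Decidable using (⌊_⌋)
open import Function.Bundles using (_⇔_)

Word : ℕ → Set
Word m = Vec Bool m

weight : ∀ {m} → Word m → ℕ
weight [] = 0
weight (true ∷ x) = suc (weight x)
weight (false ∷ x) = weight x

dist : ∀ {m} → Word m → Word m → ℕ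
dist x y = weight (zipWith _xor_ x y)

-- Vertices of the halved m-cube: words of even weight.
IsVertex : ∀ {m} → Word m → Set
IsVertex x = weight x % 2 ≡ 0

isVertexᵇ : ∀ {m} → Word m → Bool
isVertexᵇ x = (weight x % 2) ≡ᵇ 0

-- Adjacency in ½H(m): differ in exactly two positions.
adjᵇ : ∀ {m} → Word m → Word m → Bool
adjᵇ x y = dist x y ≡ᵇ 2

allWords : (m : ℕ) → List (Word m)
allWords zero = [] ∷ []
allWords (suc m) = map (false ∷_) (allWords m) ++ map (true ∷_) (allWords m)

-- A 2-colouring of the words (only its values on vertices matter):
-- cell C_i = { vertices x | col x ≡ i }.
Colouring : ℕ → Set
Colouring m = Word m → Fin 2

countᵇ : ∀ {A : Set} → (A → Bool) → List A → ℕ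
countᵇ p [] = 0
countᵇ p (a ∷ as) = if p a then suc (countᵇ p as) else countᵇ p as

nbrCount : ∀ {m} → Colouring m → Word m → Fin 2 → ℕ
nbrCount {m} col x j =
  countᵇ (λ y → isVertexᵇ y ∧ adjᵇ x y ∧ ⌊ col y ≟ᶠ j ⌋) (allWords m)

IsEquitable : ∀ {m} → Colouring m → (Fin 2 → Fin 2 → ℕ) → Set
IsEquitable {m} col S =
  ((i : Fin 2) → ∃ λ (x : Word m) → IsVertex x × col x ≡ i)
  × ((x : Word m) → IsVertex x → (j : Fin 2) → nbrCount col x j ≡ S (col x) j)

mat2 : ℕ → ℕ → ℕ → ℕ → Fin 2 → Fin 2 → ℕ
mat2 a b c d Fin.zero Fin.zero = a
mat2 a b c d Fin.zero (Fin.suc Fin.zero) = b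
mat2 a b c d (Fin.suc Fin.zero) Fin.zero = c
mat2 a b c d (Fin.suc Fin.zero) (Fin.suc Fin.zero) = d

-- An s-face of ½H(n): given by the set of free coordinates (free i ≡ true),
-- of which there are exactly s, and prescribed values on the other coordinates.
record Face (n s : ℕ) : Set where
  field
    free   : Word n
    values : Word n
    nfree  : weight free ≡ s

_∈F_ : ∀ {n s} → Word n → Face n s → Set
x ∈F F = IsVertex x × ((i : Fin _) → lookup (Face.free F) i ≡ false →
                                       lookup x i ≡ lookup (Face.values F) i)

PartitionedIntoFaces : ∀ {n} → Colouring n → ℕ → Set
PartitionedIntoFaces {n} col s =
  Σ ℕ λ k → Σ (Fin k → Face n s) λ F →
    ((x : Word n) → IsVertex x → (col x ≡ Fin.suc Fin.zero ⇔ ∃ λ i → x ∈F F i))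
    × ((i j : Fin k) (x : Word n) → x ∈F F i → x ∈F F j → i ≡ j)

-- Write a vertex of ½H(2n) as u ++ v and put z = u ⊕ v, a vertex of ½H(n). Colour u ++ v with 1 iff z lies
-- in a face F of C₁ and u has odd weight outside the free coordinates T of F. The neighbours of u ++ v are
-- (u ⊕ p) ++ (v ⊕ q) with |p| + |q| = 2: either p = q has weight 1 and z stays, or z moves to z ⊕ r with
-- |r| = 2 and p one of the four subwords of r. If r ⊆ T then z ⊕ r stays in F and, as p vanishes outside
-- T, all four neighbours keep the colour of u ++ v; otherwise a coordinate of r outside the free set of
-- the face of z ⊕ r splits the four choices of p evenly. With |T| = s this gives 2b neighbours of
-- colour 1 when z ∈ C₀, s + 2d + s(s - 1) when u is odd outside T, and (n - s) + 2d - s(s - 1) when it is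
-- even; the hypothesis s² + 2b = 2d + n makes the last count 2b and the middle one 4d + n - 2b.

module Submission where

open import Defs
open import Algebra.Bundles using (CommutativeRing)
open import Data.Bool using (Bool; true; false; _∧_; _∨_; not; _xor_)
open import Data.Bool.Properties
  using (T-≡; not-involutive; not-distribˡ-xor; not-distribʳ-xor; xor-annihilates-not; xor-assoc; xor-same;
         xor-identityʳ; ∧-zeroʳ; ∧-distribʳ-xor; xor-∧-commutativeRing)
  renaming (_≟_ to _≟ᵇ_)
open import Algebra.Properties.CommutativeSemigroup
  (CommutativeRing.+-commutativeSemigroup xor-∧-commutativeRing) using () renaming (interchange to xor-interchange)
open import Data.Empty using (⊥-elim)
open import Data.Fin using (Fin) renaming (zero to fz; suc to fs)
open import Data.Fin.Properties using () renaming (_≟_ to _≟ᶠ_; suc-injective to fs-injective)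
open import Data.List using ([]; _∷_; map) renaming (_++_ to _++ˡ_)
open import Data.Nat using (ℕ; zero; suc; _+_; _*_; _∸_; _^_; _%_; _≡ᵇ_)
open import Data.Nat.Combinatorics using (_C_; nC1≡n; nCk+nC[k+1]≡[n+1]C[k+1])
open import Data.Nat.Properties
open import Data.Nat.Tactic.RingSolver using (solve-∀)
open import Data.Product using (_×_; _,_; proj₁; proj₂; ∃)
open import Data.Vec using ([]; _∷_; zipWith; lookup; replicate; _++_; take; drop)
open import Data.Vec.Properties
  using (zipWith-identityʳ; zipWith-zeroˡ; zipWith-++; lookup-replicate; ≡-dec; take++drop≡id; ++-injectiveˡ; ++-injectiveʳ)
open import Function using (_∘_)
open import Function.Bundles using (_⇔_; Equivalence)
open import Relation.Binary.PropositionalEquality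
open import Relation.Nullary using (yes; no)
open import Relation.Nullary.Decidable using (⌊_⌋)
open ≡-Reasoning

toℕ : Bool → ℕ
toℕ true  = 1
toℕ false = 0

infixr 7 _⊙_

_⊙_ : Bool → ℕ → ℕ
true  ⊙ x = x
false ⊙ x = 0

⊙-zeroʳ : ∀ b → b ⊙ 0 ≡ 0
⊙-zeroʳ true  = refl
⊙-zeroʳ false = refl

⊙-distrib-+ : ∀ b x y → b ⊙ (x + y) ≡ b ⊙ x + b ⊙ y
⊙-distrib-+ true  x y = refl
⊙-distrib-+ false x y = refl

⊙-*-comm : ∀ b x y → b ⊙ (x * y) ≡ x * (b ⊙ y)
⊙-*-comm true  x y = refl
⊙-*-comm false x y = sym (*-zeroʳ x)

≡ᵇ-true⇒≡ : ∀ m k → (m ≡ᵇ k) ≡ true → m ≡ k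
≡ᵇ-true⇒≡ m k e = ≡ᵇ⇒≡ m k (Equivalence.from T-≡ e)

⊙-cong-≡ᵇ : ∀ m k {x y} → (m ≡ k → x ≡ y) → (m ≡ᵇ k) ⊙ x ≡ (m ≡ᵇ k) ⊙ y
⊙-cong-≡ᵇ m k f with m ≡ᵇ k in eq
... | true  = f (≡ᵇ-true⇒≡ m k eq)
... | false = refl

∑ : ∀ {m} → (Word m → ℕ) → ℕ
∑ {zero}  f = f []
∑ {suc m} f = ∑ (λ x → f (false ∷ x)) + ∑ (λ x → f (true ∷ x))

∑-cong : ∀ {m} {f g : Word m → ℕ} → (∀ x → f x ≡ g x) → ∑ f ≡ ∑ g
∑-cong {zero}  e = e []
∑-cong {suc m} e = cong₂ _+_ (∑-cong (λ x → e (false ∷ x))) (∑-cong (λ x → e (true ∷ x)))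

∑-zero : ∀ m → ∑ {m} (λ _ → 0) ≡ 0
∑-zero zero    = refl
∑-zero (suc m) = cong₂ _+_ (∑-zero m) (∑-zero m)

∑-+ : ∀ {m} (f g : Word m → ℕ) → ∑ (λ x → f x + g x) ≡ ∑ f + ∑ g
∑-+ {zero}  f g = refl
∑-+ {suc m} f g = begin
  ∑ (λ x → f (false ∷ x) + g (false ∷ x)) + ∑ (λ x → f (true ∷ x) + g (true ∷ x))
    ≡⟨ cong₂ _+_ (∑-+ (λ x → f (false ∷ x)) (λ x → g (false ∷ x))) (∑-+ (λ x → f (true ∷ x)) (λ x → g (true ∷ x))) ⟩
  (∑ (λ x → f (false ∷ x)) + ∑ (λ x → g (false ∷ x))) + (∑ (λ x → f (true ∷ x)) + ∑ (λ x → g (true ∷ x)))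
    ≡⟨ +-comm-middle (∑ (λ x → f (false ∷ x))) (∑ (λ x → g (false ∷ x))) _ _ ⟩
  ∑ f + ∑ g ∎
  where
  +-comm-middle : ∀ a b c d → (a + b) + (c + d) ≡ (a + c) + (b + d)
  +-comm-middle = solve-∀

∑-* : ∀ {m} c (f : Word m → ℕ) → ∑ (λ x → c * f x) ≡ c * ∑ f
∑-* {zero}  c f = refl
∑-* {suc m} c f =
  trans (cong₂ _+_ (∑-* c (λ x → f (false ∷ x))) (∑-* c (λ x → f (true ∷ x)))) (sym (*-distribˡ-+ c _ _))

∑-⊙ : ∀ {m} b (f : Word m → ℕ) → ∑ (λ x → b ⊙ f x) ≡ b ⊙ ∑ f
∑-⊙     true  f = refl
∑-⊙ {m} false f = ∑-zero m

∑-comm : ∀ {m k} (f : Word m → Word k → ℕ) → ∑ (λ p → ∑ (λ q → f p q)) ≡ ∑ (λ q → ∑ (λ p → f p q))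
∑-comm {zero}  f = refl
∑-comm {suc m} {k} f = begin
  ∑ (λ p → ∑ (λ q → f (false ∷ p) q)) + ∑ (λ p → ∑ (λ q → f (true ∷ p) q))
    ≡⟨ cong₂ _+_ (∑-comm {m} {k} (λ p → f (false ∷ p))) (∑-comm {m} {k} (λ p → f (true ∷ p))) ⟩
  ∑ (λ q → ∑ (λ p → f (false ∷ p) q)) + ∑ (λ q → ∑ (λ p → f (true ∷ p) q))
    ≡⟨ ∑-+ (λ q → ∑ (λ p → f (false ∷ p) q)) (λ q → ∑ (λ p → f (true ∷ p) q)) ⟨
  ∑ (λ q → ∑ (λ p → f p q)) ∎

∑-++ : ∀ m {k} (f : Word (m + k) → ℕ) → ∑ f ≡ ∑ {m} (λ p → ∑ {k} (λ q → f (p ++ q)))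
∑-++ zero    f = refl
∑-++ (suc m) f = cong₂ _+_ (∑-++ m (λ x → f (false ∷ x))) (∑-++ m (λ x → f (true ∷ x)))

∑ʷ : ∀ {m} → ℕ → (Word m → ℕ) → ℕ
∑ʷ k f = ∑ (λ r → (weight r ≡ᵇ k) ⊙ f r)

∑ʷ-cong : ∀ {m} k {f g : Word m → ℕ} → (∀ r → weight r ≡ k → f r ≡ g r) → ∑ʷ k f ≡ ∑ʷ k g
∑ʷ-cong k e = ∑-cong (λ r → ⊙-cong-≡ᵇ (weight r) k (e r))

∑ʷ-+ : ∀ {m} k (f g : Word m → ℕ) → ∑ʷ k (λ r → f r + g r) ≡ ∑ʷ k f + ∑ʷ k g
∑ʷ-+ k f g = trans (∑-cong (λ r → ⊙-distrib-+ (weight r ≡ᵇ k) (f r) (g r)))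
                   (∑-+ (λ r → (weight r ≡ᵇ k) ⊙ f r) (λ r → (weight r ≡ᵇ k) ⊙ g r))

∑ʷ-* : ∀ {m} k c (f : Word m → ℕ) → ∑ʷ k (λ r → c * f r) ≡ c * ∑ʷ k f
∑ʷ-* k c f = trans (∑-cong (λ r → ⊙-*-comm (weight r ≡ᵇ k) c (f r))) (∑-* c (λ r → (weight r ≡ᵇ k) ⊙ f r))

countᵇ-++ : ∀ {A : Set} (p : A → Bool) xs ys → countᵇ p (xs ++ˡ ys) ≡ countᵇ p xs + countᵇ p ys
countᵇ-++ p []       ys = refl
countᵇ-++ p (x ∷ xs) ys with p x
... | true  = cong suc (countᵇ-++ p xs ys)
... | false = countᵇ-++ p xs ys

countᵇ-map : ∀ {A B : Set} (p : B → Bool) (f : A → B) xs → countᵇ p (map f xs) ≡ countᵇ (λ x → p (f x)) xs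
countᵇ-map p f []       = refl
countᵇ-map p f (x ∷ xs) with p (f x)
... | true  = cong suc (countᵇ-map p f xs)
... | false = countᵇ-map p f xs

countᵇ-allWords : ∀ m (p : Word m → Bool) → countᵇ p (allWords m) ≡ ∑ (λ x → toℕ (p x))
countᵇ-allWords zero p with p []
... | true  = refl
... | false = refl
countᵇ-allWords (suc m) p = begin
  countᵇ p (map (false ∷_) (allWords m) ++ˡ map (true ∷_) (allWords m))
    ≡⟨ countᵇ-++ p (map (false ∷_) (allWords m)) _ ⟩
  countᵇ p (map (false ∷_) (allWords m)) + countᵇ p (map (true ∷_) (allWords m))
    ≡⟨ cong₂ _+_ (countᵇ-map p (false ∷_) (allWords m)) (countᵇ-map p (true ∷_) (allWords m)) ⟩
  countᵇ (λ x → p (false ∷ x)) (allWords m) + countᵇ (λ x → p (true ∷ x)) (allWords m)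
    ≡⟨ cong₂ _+_ (countᵇ-allWords m _) (countᵇ-allWords m _) ⟩
  ∑ (λ x → toℕ (p x)) ∎

infixl 6 _⊕_

_⊕_ : ∀ {m} → Word m → Word m → Word m
_⊕_ = zipWith _xor_

zeros : ∀ {m} → Word m
zeros = replicate _ false

⊕-identityʳ : ∀ {m} (x : Word m) → x ⊕ zeros ≡ x
⊕-identityʳ = zipWith-identityʳ xor-identityʳ

⊕-cancelˡ : ∀ {m} (x w : Word m) → x ⊕ (x ⊕ w) ≡ w
⊕-cancelˡ []      []      = refl
⊕-cancelˡ (a ∷ x) (b ∷ w) =
  cong₂ _∷_ (trans (sym (xor-assoc a a b)) (cong (_xor b) (xor-same a))) (⊕-cancelˡ x w)

⊕-interchange : ∀ {m} (u p v q : Word m) → (u ⊕ p) ⊕ (v ⊕ q) ≡ (u ⊕ v) ⊕ (p ⊕ q)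
⊕-interchange []      []      []      []      = refl
⊕-interchange (a ∷ u) (b ∷ p) (c ∷ v) (d ∷ q) = cong₂ _∷_ (xor-interchange a b c d) (⊕-interchange u p v q)

take-++ : ∀ {m k} (u : Word m) (v : Word k) → take m (u ++ v) ≡ u
take-++ {m} u v = ++-injectiveˡ (take m (u ++ v)) u (take++drop≡id m (u ++ v))

drop-++ : ∀ {m k} (u : Word m) (v : Word k) → drop m (u ++ v) ≡ v
drop-++ {m} u v = ++-injectiveʳ (take m (u ++ v)) u (take++drop≡id m (u ++ v))

weight-++ : ∀ {m k} (x : Word m) (y : Word k) → weight (x ++ y) ≡ weight x + weight y
weight-++ []          y = refl
weight-++ (true ∷ x)  y = cong suc (weight-++ x y)
weight-++ (false ∷ x) y = weight-++ x y

parity : ∀ {m} → Word m → Bool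
parity []       = false
parity (x ∷ xs) = x xor parity xs

parity-⊕ : ∀ {m} (x y : Word m) → parity (x ⊕ y) ≡ parity x xor parity y
parity-⊕ []      []      = refl
parity-⊕ (a ∷ x) (b ∷ y) = trans (cong ((a xor b) xor_) (parity-⊕ x y)) (xor-interchange a b (parity x) (parity y))

parity-++ : ∀ {m k} (x : Word m) (y : Word k) → parity (x ++ y) ≡ parity x xor parity y
parity-++ []      y = refl
parity-++ (a ∷ x) y = trans (cong (a xor_) (parity-++ x y)) (sym (xor-assoc a (parity x) (parity y)))

odd : ℕ → Bool
odd zero    = false
odd (suc m) = not (odd m)

%2≡toℕ[odd] : ∀ m → m % 2 ≡ toℕ (odd m)
%2≡toℕ[odd] zero          = refl
%2≡toℕ[odd] (suc zero)    = refl
%2≡toℕ[odd] (suc (suc m)) = trans (%2≡toℕ[odd] m) (cong toℕ (sym (not-involutive (odd m))))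

odd-weight : ∀ {m} (x : Word m) → odd (weight x) ≡ parity x
odd-weight []          = refl
odd-weight (true ∷ x)  = cong not (odd-weight x)
odd-weight (false ∷ x) = odd-weight x

weight%2 : ∀ {m} (x : Word m) → weight x % 2 ≡ toℕ (parity x)
weight%2 x = trans (%2≡toℕ[odd] (weight x)) (cong toℕ (odd-weight x))

isVertexᵇ≡not-parity : ∀ {m} (x : Word m) → isVertexᵇ x ≡ not (parity x)
isVertexᵇ≡not-parity x rewrite weight%2 x with parity x
... | true  = refl
... | false = refl

IsVertex⇒even : ∀ {m} (x : Word m) → IsVertex x → parity x ≡ false
IsVertex⇒even x v with parity x | weight%2 x
... | false | _  = refl
... | true  | eq with () ← trans (sym eq) v

even⇒IsVertex : ∀ {m} (x : Word m) → parity x ≡ false → IsVertex x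
even⇒IsVertex x e = trans (weight%2 x) (cong toℕ e)

weight2⇒even : ∀ {m} (r : Word m) → weight r ≡ 2 → parity r ≡ false
weight2⇒even r e = trans (sym (odd-weight r)) (cong odd e)

IsVertex-⊕ : ∀ {m} (z r : Word m) → IsVertex z → parity r ≡ false → IsVertex (z ⊕ r)
IsVertex-⊕ z r v even = even⇒IsVertex (z ⊕ r) (trans (parity-⊕ z r) (cong₂ _xor_ (IsVertex⇒even z v) even))

𝟙[_≟_] : Fin 2 → Fin 2 → ℕ
𝟙[ i ≟ j ] = toℕ ⌊ i ≟ᶠ j ⌋

∑-translate : ∀ {m} (y : Word m) (f : Word m → ℕ) → ∑ f ≡ ∑ (λ w → f (y ⊕ w))
∑-translate []          f = refl
∑-translate (false ∷ y) f = cong₂ _+_ (∑-translate y (λ x → f (false ∷ x))) (∑-translate y (λ x → f (true ∷ x)))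
∑-translate (true ∷ y)  f =
  trans (+-comm (∑ (λ x → f (false ∷ x))) _)
        (cong₂ _+_ (∑-translate y (λ x → f (true ∷ x))) (∑-translate y (λ x → f (false ∷ x))))

nbrCount-translates : ∀ {m} (col : Colouring m) (y : Word m) → parity y ≡ false → ∀ j →
  nbrCount col y j ≡ ∑ʷ 2 (λ w → 𝟙[ col (y ⊕ w) ≟ j ])
nbrCount-translates {m} col y even j =
  trans (countᵇ-allWords m _) (trans (∑-translate y _) (∑-cong term))
  where
  even-weight2 : ∀ W q → not (odd W) ∧ (W ≡ᵇ 2) ∧ q ≡ (W ≡ᵇ 2) ∧ q
  even-weight2 zero                q = refl
  even-weight2 (suc zero)          q = refl
  even-weight2 (suc (suc zero))    q = refl
  even-weight2 (suc (suc (suc W))) q = ∧-zeroʳ (not (odd (3 + W)))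
  toℕ-∧ : ∀ a b → toℕ (a ∧ b) ≡ a ⊙ toℕ b
  toℕ-∧ true  b = refl
  toℕ-∧ false b = refl
  term : ∀ w → toℕ (isVertexᵇ (y ⊕ w) ∧ adjᵇ y (y ⊕ w) ∧ ⌊ col (y ⊕ w) ≟ᶠ j ⌋)
             ≡ (weight w ≡ᵇ 2) ⊙ 𝟙[ col (y ⊕ w) ≟ j ]
  term w rewrite isVertexᵇ≡not-parity (y ⊕ w) | parity-⊕ y w | even | ⊕-cancelˡ y w | sym (odd-weight w) =
    trans (cong toℕ (even-weight2 (weight w) _)) (toℕ-∧ (weight w ≡ᵇ 2) _)

weight2-count : ℕ → ℕ
weight2-count m = ∑ʷ {m} 2 (λ _ → 1)

degree : ∀ {m} (col : Colouring m) (y : Word m) → parity y ≡ false →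
  nbrCount col y fz + nbrCount col y (fs fz) ≡ weight2-count m
degree {m} col y even = begin
  nbrCount col y fz + nbrCount col y (fs fz)
    ≡⟨ cong₂ _+_ (nbrCount-translates col y even fz) (nbrCount-translates col y even (fs fz)) ⟩
  ∑ʷ 2 (λ w → 𝟙[ col (y ⊕ w) ≟ fz ]) + ∑ʷ 2 (λ w → 𝟙[ col (y ⊕ w) ≟ fs fz ])
    ≡⟨ ∑ʷ-+ 2 (λ w → 𝟙[ col (y ⊕ w) ≟ fz ]) (λ w → 𝟙[ col (y ⊕ w) ≟ fs fz ]) ⟨
  ∑ʷ 2 (λ w → 𝟙[ col (y ⊕ w) ≟ fz ] + 𝟙[ col (y ⊕ w) ≟ fs fz ])
    ≡⟨ ∑ʷ-cong 2 (λ w _ → one-cell (col (y ⊕ w))) ⟩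
  weight2-count m ∎
  where
  one-cell : ∀ i → 𝟙[ i ≟ fz ] + 𝟙[ i ≟ fs fz ] ≡ 1
  one-cell fz      = refl
  one-cell (fs fz) = refl

infix 5 _⊆ᵇ_
infixl 7 _∖_

_⊆ᵇ_ : ∀ {m} → Word m → Word m → Bool
[]      ⊆ᵇ []      = true
(a ∷ p) ⊆ᵇ (b ∷ r) = (not a ∨ b) ∧ (p ⊆ᵇ r)

_∖_ : ∀ {m} → Word m → Word m → Word m
_∖_ = zipWith (λ a t → a ∧ not t)

∑⊆ : ∀ {m} → Word m → (Word m → ℕ) → ℕ
∑⊆ r f = ∑ (λ p → (p ⊆ᵇ r) ⊙ f p)

weight-⊕ : ∀ {m} (p r : Word m) → weight p + weight (p ⊕ r) ≡ weight r + 2 * weight (p ∖ r)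
weight-⊕ []          []          = refl
weight-⊕ (true ∷ p)  (false ∷ r) = trans (shift (weight p) _) (trans (cong (2 +_) (weight-⊕ p r)) (sym (shift₂ (weight r) _)))
  where
  shift : ∀ x y → suc x + suc y ≡ 2 + (x + y)
  shift = solve-∀
  shift₂ : ∀ x y → x + 2 * suc y ≡ 2 + (x + 2 * y)
  shift₂ = solve-∀
weight-⊕ (true ∷ p)  (true ∷ r)  = cong suc (weight-⊕ p r)
weight-⊕ (false ∷ p) (false ∷ r) = weight-⊕ p r
weight-⊕ (false ∷ p) (true ∷ r)  = trans (+-suc (weight p) _) (cong suc (weight-⊕ p r))

⊆ᵇ≡∖-empty : ∀ {m} (p r : Word m) → (p ⊆ᵇ r) ≡ (weight (p ∖ r) ≡ᵇ 0)
⊆ᵇ≡∖-empty []          []          = refl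
⊆ᵇ≡∖-empty (true ∷ p)  (false ∷ r) = refl
⊆ᵇ≡∖-empty (true ∷ p)  (true ∷ r)  = ⊆ᵇ≡∖-empty p r
⊆ᵇ≡∖-empty (false ∷ p) (b ∷ r)     = ⊆ᵇ≡∖-empty p r

∖-weight0 : ∀ {m} (p r : Word m) → weight r ≡ 0 → weight (p ∖ r) ≡ weight p
∖-weight0 []          []          _ = refl
∖-weight0 (true ∷ p)  (false ∷ r) e = cong suc (∖-weight0 p r e)
∖-weight0 (false ∷ p) (false ∷ r) e = ∖-weight0 p r e

∑ʷ0 : ∀ {m} (G : Word m → ℕ) → ∑ʷ 0 G ≡ G zeros
∑ʷ0 {zero}  G = refl
∑ʷ0 {suc m} G = trans (cong₂ _+_ (∑ʷ0 (λ x → G (false ∷ x))) (∑-zero m)) (+-identityʳ _)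

-- A pair (p , p ⊕ r) has total weight 2 iff either r = 0 and |p| = 1, or |r| = 2 and p ⊆ r;
-- by weight-⊕ this is a statement about |r| and |p ∖ r| alone.
weight-pair : ∀ {m} (p r : Word m) X →
  (weight p + weight (p ⊕ r) ≡ᵇ 2) ⊙ X ≡ (weight r ≡ᵇ 0) ⊙ (weight p ≡ᵇ 1) ⊙ X + (weight r ≡ᵇ 2) ⊙ (p ⊆ᵇ r) ⊙ X
weight-pair p r X rewrite weight-⊕ p r | ⊆ᵇ≡∖-empty p r =
  cases (weight r) (weight (p ∖ r)) (weight p) (λ e → sym (∖-weight0 p r e))
  where
  cases : ∀ a c w → (a ≡ 0 → w ≡ c) →
    (a + 2 * c ≡ᵇ 2) ⊙ X ≡ (a ≡ᵇ 0) ⊙ (w ≡ᵇ 1) ⊙ X + (a ≡ᵇ 2) ⊙ (c ≡ᵇ 0) ⊙ X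
  cases zero c w e with refl ← e refl with c
  ... | zero          = refl
  ... | suc zero      = sym (+-identityʳ X)
  ... | suc (suc c)   rewrite +-suc c (suc (c + 0)) = refl
  cases 1 zero          w e = refl
  cases 1 (suc c)       w e rewrite +-suc c (c + 0) = refl
  cases 2 zero          w e = refl
  cases 2 (suc c)       w e = refl
  cases (suc (suc (suc a))) c w e = refl

∑-pairs : ∀ {m} (Φ : Word m → Word m → ℕ) →
  ∑ (λ p → ∑ (λ q → (weight p + weight q ≡ᵇ 2) ⊙ Φ p (p ⊕ q)))
  ≡ ∑ʷ 1 (λ p → Φ p zeros) + ∑ʷ 2 (λ r → ∑⊆ r (λ p → Φ p r))
∑-pairs {m} Φ = begin
  ∑ (λ p → ∑ (λ q → (weight p + weight q ≡ᵇ 2) ⊙ Φ p (p ⊕ q)))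
    ≡⟨ ∑-cong (λ p → trans (∑-translate p _) (∑-cong (λ r → cong (λ t → (weight p + weight (p ⊕ r) ≡ᵇ 2) ⊙ Φ p t) (⊕-cancelˡ p r)))) ⟩
  ∑ (λ p → ∑ (λ r → (weight p + weight (p ⊕ r) ≡ᵇ 2) ⊙ Φ p r))
    ≡⟨ ∑-comm (λ p r → (weight p + weight (p ⊕ r) ≡ᵇ 2) ⊙ Φ p r) ⟩
  ∑ (λ r → ∑ (λ p → (weight p + weight (p ⊕ r) ≡ᵇ 2) ⊙ Φ p r))
    ≡⟨ ∑-cong (λ r → trans (∑-cong (λ p → weight-pair p r (Φ p r))) (∑-+ (single r) (double r))) ⟩
  ∑ (λ r → ∑ (single r) + ∑ (double r))
    ≡⟨ ∑-+ (λ r → ∑ (single r)) (λ r → ∑ (double r)) ⟩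
  ∑ (λ r → ∑ (single r)) + ∑ (λ r → ∑ (double r))
    ≡⟨ cong₂ _+_ (trans (∑-cong (λ r → ∑-⊙ (weight r ≡ᵇ 0) (λ p → (weight p ≡ᵇ 1) ⊙ Φ p r))) (∑ʷ0 (λ r → ∑ (λ p → (weight p ≡ᵇ 1) ⊙ Φ p r))))
                 (∑-cong (λ r → ∑-⊙ (weight r ≡ᵇ 2) (λ p → (p ⊆ᵇ r) ⊙ Φ p r))) ⟩
  ∑ʷ 1 (λ p → Φ p zeros) + ∑ʷ 2 (λ r → ∑⊆ r (λ p → Φ p r)) ∎
  where
  single double : Word m → Word m → ℕ
  single r p = (weight r ≡ᵇ 0) ⊙ (weight p ≡ᵇ 1) ⊙ Φ p r
  double r p = (weight r ≡ᵇ 2) ⊙ (p ⊆ᵇ r) ⊙ Φ p r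

ones : ∀ {m} → Word m
ones = replicate _ true

weight-ones : ∀ m → weight (ones {m}) ≡ m
weight-ones zero    = refl
weight-ones (suc m) = cong suc (weight-ones m)

⊆ᵇ-ones : ∀ {m} (r : Word m) → r ⊆ᵇ ones ≡ true
⊆ᵇ-ones []      = refl
⊆ᵇ-ones (a ∷ r) rewrite ⊆ᵇ-ones r with a
... | true  = refl
... | false = refl

subsets-of-weight : ∀ {m} (T : Word m) k → ∑ʷ k (λ r → toℕ (r ⊆ᵇ T)) ≡ weight T C k
subsets-of-weight []          zero    = refl
subsets-of-weight []          (suc k) = refl
subsets-of-weight {suc m} (false ∷ T) k =
  trans (cong₂ _+_ (subsets-of-weight T k) (trans (∑-cong {m} (λ r → ⊙-zeroʳ (suc (weight r) ≡ᵇ k))) (∑-zero m)))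
        (+-identityʳ _)
subsets-of-weight {suc m} (true ∷ T) zero    = cong₂ _+_ (subsets-of-weight T zero) (∑-zero m)
subsets-of-weight         (true ∷ T) (suc k) =
  trans (cong₂ _+_ (subsets-of-weight T (suc k)) (subsets-of-weight T k))
        (trans (+-comm (weight T C suc k) _) (nCk+nC[k+1]≡[n+1]C[k+1] (weight T) k))

words-of-weight : ∀ m k → ∑ʷ {m} k (λ _ → 1) ≡ m C k
words-of-weight m k = begin
  ∑ʷ {m} k (λ _ → 1)                           ≡⟨ ∑ʷ-cong {m} k (λ r _ → cong toℕ (sym (⊆ᵇ-ones r))) ⟩
  ∑ʷ k (λ r → toℕ (r ⊆ᵇ ones {m}))            ≡⟨ subsets-of-weight (ones {m}) k ⟩
  weight (ones {m}) C k                          ≡⟨ cong (_C k) (weight-ones m) ⟩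
  m C k                                          ∎

∑⊆-const : ∀ {m} (r : Word m) c → ∑⊆ r (λ _ → c) ≡ 2 ^ weight r * c
∑⊆-const         []          c = sym (+-identityʳ c)
∑⊆-const {suc m} (false ∷ r) c = trans (cong₂ _+_ (∑⊆-const r c) (∑-zero m)) (+-identityʳ _)
∑⊆-const         (true ∷ r)  c = trans (cong₂ _+_ (∑⊆-const r c) (∑⊆-const r c)) (double (2 ^ weight r) c)
  where
  double : ∀ x c → x * c + x * c ≡ (2 * x) * c
  double = solve-∀

2*nC2+n≡n*n : ∀ n → 2 * (n C 2) + n ≡ n * n
2*nC2+n≡n*n zero    = refl
2*nC2+n≡n*n (suc n) = begin
  2 * (suc n C 2) + suc n             ≡⟨ cong (λ t → 2 * t + suc n) (sym (nCk+nC[k+1]≡[n+1]C[k+1] n 1)) ⟩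
  2 * (n C 1 + n C 2) + suc n         ≡⟨ cong (λ t → 2 * (t + n C 2) + suc n) (nC1≡n n) ⟩
  2 * (n + n C 2) + suc n             ≡⟨ regroup n (n C 2) ⟩
  (2 * (n C 2) + n) + (2 * n + 1)     ≡⟨ cong (_+ (2 * n + 1)) (2*nC2+n≡n*n n) ⟩
  n * n + (2 * n + 1)                 ≡⟨ square n ⟩
  suc n * suc n                       ∎
  where
  regroup : ∀ n c → 2 * (n + c) + suc n ≡ (2 * c + n) + (2 * n + 1)
  regroup = solve-∀
  square : ∀ n → n * n + (2 * n + 1) ≡ suc n * suc n
  square = solve-∀

∖-distrib-⊕ : ∀ {m} (u p T : Word m) → (u ⊕ p) ∖ T ≡ u ∖ T ⊕ p ∖ T
∖-distrib-⊕ []      []      []      = refl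
∖-distrib-⊕ (a ∷ u) (b ∷ p) (t ∷ T) = cong₂ _∷_ (∧-distribʳ-xor (not t) a b) (∖-distrib-⊕ u p T)

parity-∖-⊕ : ∀ {m} (u p T : Word m) → parity ((u ⊕ p) ∖ T) ≡ parity (u ∖ T) xor parity (p ∖ T)
parity-∖-⊕ u p T = trans (cong parity (∖-distrib-⊕ u p T)) (parity-⊕ (u ∖ T) (p ∖ T))

⊆ᵇ⇒parity-∖ : ∀ {m} (p T : Word m) → p ⊆ᵇ T ≡ true → parity (p ∖ T) ≡ false
⊆ᵇ⇒parity-∖ p T e =
  trans (sym (odd-weight (p ∖ T))) (cong odd (≡ᵇ-true⇒≡ (weight (p ∖ T)) 0 (trans (sym (⊆ᵇ≡∖-empty p T)) e)))

∧-true : ∀ {a b} → a ∧ b ≡ true → a ≡ true × b ≡ true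
∧-true {true} e = refl , e

⊆ᵇ-trans : ∀ {m} (p r T : Word m) → p ⊆ᵇ r ≡ true → r ⊆ᵇ T ≡ true → p ⊆ᵇ T ≡ true
⊆ᵇ-trans []          []         []         _  _  = refl
⊆ᵇ-trans (false ∷ p) (_ ∷ r)    (_ ∷ T)    e₁ e₂ = ⊆ᵇ-trans p r T e₁ (proj₂ (∧-true e₂))
⊆ᵇ-trans (true ∷ p)  (true ∷ r) (true ∷ T) e₁ e₂ = ⊆ᵇ-trans p r T e₁ e₂

weight0⇒⊆ᵇ : ∀ {m} (p T : Word m) → weight p ≡ 0 → p ⊆ᵇ T ≡ true
weight0⇒⊆ᵇ []          []      _ = refl
weight0⇒⊆ᵇ (false ∷ p) (_ ∷ T) e = weight0⇒⊆ᵇ p T e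

weight1⇒parity-∖ : ∀ {m} (p T : Word m) → weight p ≡ 1 → parity (p ∖ T) ≡ not (p ⊆ᵇ T)
weight1⇒parity-∖ (false ∷ p) (t ∷ T)     e = weight1⇒parity-∖ p T e
weight1⇒parity-∖ (true ∷ p)  (true ∷ T)  e
  rewrite ⊆ᵇ⇒parity-∖ p T (weight0⇒⊆ᵇ p T (suc-injective e)) | weight0⇒⊆ᵇ p T (suc-injective e) = refl
weight1⇒parity-∖ (true ∷ p)  (false ∷ T) e
  rewrite ⊆ᵇ⇒parity-∖ p T (weight0⇒⊆ᵇ p T (suc-injective e)) = refl

oddCount : ∀ {m} → Word m → Word m → Bool → ℕ
oddCount T r b = ∑⊆ r (λ p → toℕ (b xor parity (p ∖ T)))

oddCount-complement : ∀ {m} (T r : Word m) b → oddCount T r b + oddCount T r (not b) ≡ 2 ^ weight r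
oddCount-complement T r b = begin
  oddCount T r b + oddCount T r (not b)
    ≡⟨ ∑-+ (λ p → (p ⊆ᵇ r) ⊙ toℕ (b xor parity (p ∖ T))) (λ p → (p ⊆ᵇ r) ⊙ toℕ (not b xor parity (p ∖ T))) ⟨
  ∑ (λ p → (p ⊆ᵇ r) ⊙ toℕ (b xor parity (p ∖ T)) + (p ⊆ᵇ r) ⊙ toℕ (not b xor parity (p ∖ T)))
    ≡⟨ ∑-cong (λ p → exactly-one (p ⊆ᵇ r) b (parity (p ∖ T))) ⟩
  ∑⊆ r (λ _ → 1)
    ≡⟨ trans (∑⊆-const r 1) (*-identityʳ _) ⟩
  2 ^ weight r ∎
  where
  exactly-one : ∀ c b x → c ⊙ toℕ (b xor x) + c ⊙ toℕ (not b xor x) ≡ c ⊙ 1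
  exactly-one true  true  true  = refl
  exactly-one true  true  false = refl
  exactly-one true  false true  = refl
  exactly-one true  false false = refl
  exactly-one false b     x     = refl

-- Toggling a coordinate of r outside T is a bijection between the p ⊆ r of either parity.
oddCount-not : ∀ {m} (T r : Word m) b → r ⊆ᵇ T ≡ false → oddCount T r b ≡ oddCount T r (not b)
oddCount-not         []          []          b ()
oddCount-not {suc m} (t ∷ T)     (false ∷ r) b e = cong (_+ ∑ {m} (λ _ → 0)) (oddCount-not T r b e)
oddCount-not         (true ∷ T)  (true ∷ r)  b e = cong₂ _+_ (oddCount-not T r b e) (oddCount-not T r b e)
oddCount-not {suc m} (false ∷ T) (true ∷ r)  b e = begin
  oddCount T r b + ∑⊆ r (λ p → toℕ (b xor not (parity (p ∖ T))))
    ≡⟨ cong (oddCount T r b +_) (∑-cong {m} (λ p → cong (λ x → (p ⊆ᵇ r) ⊙ toℕ x) (sym (not-distribʳ-xor b _)))) ⟩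
  oddCount T r b + ∑⊆ r (λ p → toℕ (not (b xor parity (p ∖ T))))
    ≡⟨ +-comm (oddCount T r b) _ ⟩
  ∑⊆ r (λ p → toℕ (not (b xor parity (p ∖ T)))) + oddCount T r b
    ≡⟨ cong (_+ oddCount T r b) (∑-cong {m} (λ p → cong (λ x → (p ⊆ᵇ r) ⊙ toℕ x) (not-distribˡ-xor b _))) ⟩
  oddCount T r (not b) + oddCount T r b
    ≡⟨ cong (oddCount T r (not b) +_) (∑-cong {m} (λ p → cong (λ x → (p ⊆ᵇ r) ⊙ toℕ x) (sym (xor-annihilates-not b _)))) ⟩
  oddCount T r (not b) + ∑⊆ r (λ p → toℕ (not b xor not (parity (p ∖ T)))) ∎

oddCount-⊆ : ∀ {m} (T r : Word m) b → r ⊆ᵇ T ≡ true → oddCount T r b ≡ 2 ^ weight r * toℕ b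
oddCount-⊆ T r b e = trans (∑-cong term) (∑⊆-const r (toℕ b))
  where
  term : ∀ p → (p ⊆ᵇ r) ⊙ toℕ (b xor parity (p ∖ T)) ≡ (p ⊆ᵇ r) ⊙ toℕ b
  term p with p ⊆ᵇ r in p⊆r
  ... | true  = cong toℕ (trans (cong (b xor_) (⊆ᵇ⇒parity-∖ p T (⊆ᵇ-trans p r T p⊆r e))) (xor-identityʳ b))
  ... | false = refl

oddCount-pair : ∀ {m} (T r : Word m) b → weight r ≡ 2 → r ⊆ᵇ T ≡ false → oddCount T r b ≡ 2
oddCount-pair T r b w e = *-cancelˡ-≡ (oddCount T r b) 2 2 (begin
  2 * oddCount T r b                       ≡⟨ cong (oddCount T r b +_) (+-identityʳ _) ⟩
  oddCount T r b + oddCount T r b          ≡⟨ cong (oddCount T r b +_) (oddCount-not T r b e) ⟩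
  oddCount T r b + oddCount T r (not b)    ≡⟨ oddCount-complement T r b ⟩
  2 ^ weight r                             ≡⟨ cong (2 ^_) w ⟩
  4                                        ∎)

agreesOutside : ∀ {m} → Word m → Word m → Word m → Bool
agreesOutside []      []      []      = true
agreesOutside (t ∷ T) (v ∷ V) (x ∷ xs) = (t ∨ not (x xor v)) ∧ agreesOutside T V xs

agreesOutside-sound : ∀ {m} (T V x : Word m) → agreesOutside T V x ≡ true →
  ∀ i → lookup T i ≡ false → lookup x i ≡ lookup V i
agreesOutside-sound (false ∷ T) (true ∷ V)  (true ∷ x)  e fz      refl = refl
agreesOutside-sound (false ∷ T) (false ∷ V) (false ∷ x) e fz      refl = refl
agreesOutside-sound (t ∷ T)     (v ∷ V)     (x ∷ xs)    e (fs i) f    = agreesOutside-sound T V xs (proj₂ (∧-true e)) i f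

agreesOutside-complete : ∀ {m} (T V x : Word m) → (∀ i → lookup T i ≡ false → lookup x i ≡ lookup V i) →
  agreesOutside T V x ≡ true
agreesOutside-complete []          []      []       h = refl
agreesOutside-complete (true ∷ T)  (v ∷ V) (x ∷ xs) h = agreesOutside-complete T V xs (λ i → h (fs i))
agreesOutside-complete (false ∷ T) (v ∷ V) (x ∷ xs) h with h fz refl
agreesOutside-complete (false ∷ T) (true ∷ V)  (.true ∷ xs)  h | refl = agreesOutside-complete T V xs (λ i → h (fs i))
agreesOutside-complete (false ∷ T) (false ∷ V) (.false ∷ xs) h | refl = agreesOutside-complete T V xs (λ i → h (fs i))

agreesOutside-⊕ : ∀ {m} (T V z r : Word m) → r ⊆ᵇ T ≡ true → agreesOutside T V (z ⊕ r) ≡ agreesOutside T V z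
agreesOutside-⊕ []         []      []       []          e = refl
agreesOutside-⊕ (t ∷ T)    (v ∷ V) (a ∷ z)  (false ∷ r) e rewrite xor-identityʳ a = cong (_ ∧_) (agreesOutside-⊕ T V z r e)
agreesOutside-⊕ (true ∷ T) (v ∷ V) (a ∷ z)  (true ∷ r)  e = agreesOutside-⊕ T V z r e

memberᵇ : ∀ {n s} → Face n s → Word n → Bool
memberᵇ F x = not (parity x) ∧ agreesOutside (Face.free F) (Face.values F) x

memberᵇ-sound : ∀ {n s} (F : Face n s) x → memberᵇ F x ≡ true → x ∈F F
memberᵇ-sound F x e with ∧-true e
... | even , agrees = even⇒IsVertex x (trans (sym (not-involutive _)) (cong not even)) ,
                      agreesOutside-sound (Face.free F) (Face.values F) x agrees

memberᵇ-complete : ∀ {n s} (F : Face n s) x → x ∈F F → memberᵇ F x ≡ true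
memberᵇ-complete F x (v , agrees) rewrite IsVertex⇒even x v =
  agreesOutside-complete (Face.free F) (Face.values F) x agrees

memberᵇ-⊕ : ∀ {n s} (F : Face n s) z r → parity r ≡ false → r ⊆ᵇ Face.free F ≡ true →
  memberᵇ F (z ⊕ r) ≡ memberᵇ F z
memberᵇ-⊕ F z r even r⊆T
  rewrite parity-⊕ z r | even | xor-identityʳ (parity z) | agreesOutside-⊕ (Face.free F) (Face.values F) z r r⊆T = refl

parity-zeros : ∀ m → parity (zeros {m}) ≡ false
parity-zeros zero    = refl
parity-zeros (suc m) = parity-zeros m

odd-off : ∀ {m} (T : Word m) → T ≢ ones → ∃ λ u → parity (u ∖ T) ≡ true
odd-off []          T≢ones = ⊥-elim (T≢ones refl)
odd-off {suc m} (false ∷ T) _ =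
  true ∷ zeros , cong not (trans (cong parity (zipWith-zeroˡ (λ _ → refl) T)) (parity-zeros m))
odd-off (true ∷ T)  T≢ones with u , odd ← odd-off T (T≢ones ∘ cong (true ∷_)) = false ∷ u , odd

all-free⇒∈F : ∀ {n s} (F : Face n s) x → Face.free F ≡ ones → IsVertex x → x ∈F F
all-free⇒∈F F x all-free v = v , λ i bound → ⊥-elim (true≢false (trans (sym (lookup-replicate i true))
                                                                      (trans (cong (λ T → lookup T i) (sym all-free)) bound)))
  where
  true≢false : true ≢ false
  true≢false ()

anyFin : ∀ k → (Fin k → Bool) → Bool
anyFin zero    P = false
anyFin (suc k) P = P fz ∨ anyFin k (λ i → P (fs i))

anyFin-false : ∀ k (P : Fin k → Bool) → (∀ i → P i ≡ false) → anyFin k P ≡ false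
anyFin-false zero    P h = refl
anyFin-false (suc k) P h rewrite h fz = anyFin-false k (λ i → P (fs i)) (λ i → h (fs i))

anyFin-unique : ∀ k (P : Fin k → Bool) i → (∀ j → P j ≡ true → j ≡ i) → anyFin k P ≡ P i
anyFin-unique (suc k) P fz h with P fz
... | true  = refl
... | false = anyFin-false k (λ i → P (fs i)) others
  where
  others : ∀ j → P (fs j) ≡ false
  others j with P (fs j) in eq
  ... | true  with () ← h (fs j) eq
  ... | false = refl
anyFin-unique (suc k) P (fs i) h with P fz in eq
... | true  with () ← h fz eq
... | false = anyFin-unique k (λ j → P (fs j)) i (λ j e → fs-injective (h (fs j) e))

toFin : Bool → Fin 2
toFin true  = fs fz
toFin false = fz

𝟙[toFin≟1] : ∀ x → 𝟙[ toFin x ≟ fs fz ] ≡ toℕ x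
𝟙[toFin≟1] true  = refl
𝟙[toFin≟1] false = refl

weight2-count-+ : ∀ n → weight2-count (n + n) ≡ n + 4 * weight2-count n
weight2-count-+ n = begin
  weight2-count (n + n)
    ≡⟨ ∑-++ n (λ w → (weight w ≡ᵇ 2) ⊙ 1) ⟩
  ∑ {n} (λ p → ∑ {n} (λ q → (weight (p ++ q) ≡ᵇ 2) ⊙ 1))
    ≡⟨ ∑-cong {n} (λ p → ∑-cong {n} (λ q → cong (λ w → (w ≡ᵇ 2) ⊙ 1) (weight-++ p q))) ⟩
  ∑ {n} (λ p → ∑ {n} (λ q → (weight p + weight q ≡ᵇ 2) ⊙ 1))
    ≡⟨ ∑-pairs {n} (λ _ _ → 1) ⟩
  ∑ʷ {n} 1 (λ _ → 1) + ∑ʷ {n} 2 (λ r → ∑⊆ r (λ _ → 1))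
    ≡⟨ cong₂ _+_ (trans (words-of-weight n 1) (nC1≡n n)) (∑ʷ-cong {n} 2 four) ⟩
  n + ∑ʷ {n} 2 (λ _ → 4 * 1)
    ≡⟨ cong (n +_) (∑ʷ-* {n} 2 4 (λ _ → 1)) ⟩
  n + 4 * weight2-count n ∎
  where
  four : ∀ r → weight r ≡ 2 → ∑⊆ r (λ _ → 1) ≡ 4 * 1
  four r w = trans (∑⊆-const r 1) (cong (λ t → 2 ^ t * 1) w)

lifted : ℕ → ℕ → ℕ → ℕ → ℕ → Fin 2 → Fin 2 → ℕ
lifted n a b c d = mat2 (4 * a + n + 2 * b) (2 * b) (4 * c + 2 * b) (4 * d + n ∸ 2 * b)

row₀ : ∀ n a b c d {D} (N : Fin 2 → ℕ) → a + b ≡ D → N fz + N (fs fz) ≡ n + 4 * D → N (fs fz) ≡ 2 * b →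
  ∀ j → N j ≡ lifted n a b c d fz j
row₀ n a b c d N refl total N₁ fz = +-cancelʳ-≡ (2 * b) (N fz) _ (begin
  N fz + 2 * b                 ≡⟨ cong (N fz +_) (sym N₁) ⟩
  N fz + N (fs fz)             ≡⟨ total ⟩
  n + 4 * (a + b)              ≡⟨ regroup n a b ⟩
  4 * a + n + 2 * b + 2 * b    ∎)
  where
  regroup : ∀ n a b → n + 4 * (a + b) ≡ 4 * a + n + 2 * b + 2 * b
  regroup = solve-∀
row₀ n a b c d N _ _ N₁ (fs fz) = N₁

row₁ : ∀ n a b c d {D} (N : Fin 2 → ℕ) → c + d ≡ D → N fz + N (fs fz) ≡ n + 4 * D → N (fs fz) + 2 * b ≡ 4 * d + n →
  ∀ j → N j ≡ lifted n a b c d (fs fz) j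
row₁ n a b c d N refl total N₁ fz = +-cancelʳ-≡ (N (fs fz) + 2 * b) (N fz) _ (begin
  N fz + (N (fs fz) + 2 * b)            ≡⟨ sym (+-assoc (N fz) _ _) ⟩
  N fz + N (fs fz) + 2 * b              ≡⟨ cong (_+ 2 * b) total ⟩
  n + 4 * (c + d) + 2 * b               ≡⟨ regroup n c d b ⟩
  4 * c + 2 * b + (4 * d + n)           ≡⟨ cong (4 * c + 2 * b +_) (sym N₁) ⟩
  4 * c + 2 * b + (N (fs fz) + 2 * b)   ∎)
  where
  regroup : ∀ n c d b → n + 4 * (c + d) + 2 * b ≡ 4 * c + 2 * b + (4 * d + n)
  regroup = solve-∀
row₁ n a b c d N _ _ N₁ (fs fz) = trans (sym (m+n∸n≡m (N (fs fz)) (2 * b))) (cong (_∸ 2 * b) N₁)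

odd-case-count : ∀ {A R s q b d n} → A ≡ s → R + 2 * q ≡ 2 * d + 4 * q → 2 * q + s ≡ s * s →
  s * s + 2 * b ≡ 2 * d + n → A + R + 2 * b ≡ 4 * d + n
odd-case-count {A} {R} {s} {q} {b} {d} {n} refl hR hq hs = +-cancelʳ-≡ (2 * q) _ _ (begin
  A + R + 2 * b + 2 * q              ≡⟨ regroup₁ A R b q ⟩
  A + 2 * b + (R + 2 * q)            ≡⟨ cong (A + 2 * b +_) hR ⟩
  A + 2 * b + (2 * d + 4 * q)        ≡⟨ regroup₂ A b d q ⟩
  (2 * q + A) + 2 * b + 2 * d + 2 * q ≡⟨ cong (λ t → t + 2 * b + 2 * d + 2 * q) hq ⟩
  A * A + 2 * b + 2 * d + 2 * q      ≡⟨ cong (λ t → t + 2 * d + 2 * q) hs ⟩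
  2 * d + n + 2 * d + 2 * q          ≡⟨ regroup₃ d n q ⟩
  4 * d + n + 2 * q                  ∎)
  where
  regroup₁ : ∀ A R b q → A + R + 2 * b + 2 * q ≡ A + 2 * b + (R + 2 * q)
  regroup₁ = solve-∀
  regroup₂ : ∀ A b d q → A + 2 * b + (2 * d + 4 * q) ≡ (2 * q + A) + 2 * b + 2 * d + 2 * q
  regroup₂ = solve-∀
  regroup₃ : ∀ d n q → 2 * d + n + 2 * d + 2 * q ≡ 4 * d + n + 2 * q
  regroup₃ = solve-∀

even-case-count : ∀ {A R s q b d n} → A + s ≡ n → R + 2 * q ≡ 2 * d → 2 * q + s ≡ s * s →
  s * s + 2 * b ≡ 2 * d + n → A + R ≡ 2 * b
even-case-count {A} {R} {s} {q} {b} {d} {n} hA hR hq hs = +-cancelʳ-≡ (2 * q + s) _ _ (begin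
  A + R + (2 * q + s)     ≡⟨ regroup₁ A R q s ⟩
  (A + s) + (R + 2 * q)   ≡⟨ cong₂ _+_ hA hR ⟩
  n + 2 * d               ≡⟨ +-comm n (2 * d) ⟩
  2 * d + n               ≡⟨ hs ⟨
  s * s + 2 * b           ≡⟨ cong (_+ 2 * b) hq ⟨
  2 * q + s + 2 * b       ≡⟨ +-comm (2 * q + s) (2 * b) ⟩
  2 * b + (2 * q + s)     ∎)
  where
  regroup₁ : ∀ A R q s → A + R + (2 * q + s) ≡ (A + s) + (R + 2 * q)
  regroup₁ = solve-∀

module Lift {n} (χ : Word n → Word n → Bool) where

  colouring : Colouring (n + n)
  colouring y = toFin (χ (take n y) (take n y ⊕ drop n y))

  colouring-++ : ∀ u v → colouring (u ++ v) ≡ toFin (χ u (u ⊕ v))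
  colouring-++ u v rewrite take-++ u v | drop-++ u v = refl

  nbrCount-++ : ∀ u v → parity (u ++ v) ≡ false →
    nbrCount colouring (u ++ v) (fs fz)
      ≡ ∑ʷ 1 (λ p → toℕ (χ (u ⊕ p) (u ⊕ v))) + ∑ʷ 2 (λ r → ∑⊆ r (λ p → toℕ (χ (u ⊕ p) ((u ⊕ v) ⊕ r))))
  nbrCount-++ u v even = begin
    nbrCount colouring (u ++ v) (fs fz)
      ≡⟨ nbrCount-translates colouring (u ++ v) even (fs fz) ⟩
    ∑ʷ 2 (λ w → 𝟙[ colouring ((u ++ v) ⊕ w) ≟ fs fz ])
      ≡⟨ ∑-++ n (λ w → (weight w ≡ᵇ 2) ⊙ 𝟙[ colouring ((u ++ v) ⊕ w) ≟ fs fz ]) ⟩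
    ∑ {n} (λ p → ∑ {n} (λ q → (weight (p ++ q) ≡ᵇ 2) ⊙ 𝟙[ colouring ((u ++ v) ⊕ (p ++ q)) ≟ fs fz ]))
      ≡⟨ ∑-cong {n} (λ p → ∑-cong {n} (λ q → term p q)) ⟩
    ∑ (λ p → ∑ (λ q → (weight p + weight q ≡ᵇ 2) ⊙ Φ p (p ⊕ q)))
      ≡⟨ ∑-pairs Φ ⟩
    ∑ʷ 1 (λ p → Φ p zeros) + ∑ʷ 2 (λ r → ∑⊆ r (λ p → Φ p r))
      ≡⟨ cong (λ z → ∑ʷ 1 (λ p → toℕ (χ (u ⊕ p) z)) + ∑ʷ 2 (λ r → ∑⊆ r (λ p → Φ p r))) (⊕-identityʳ (u ⊕ v)) ⟩
    ∑ʷ 1 (λ p → toℕ (χ (u ⊕ p) (u ⊕ v))) + ∑ʷ 2 (λ r → ∑⊆ r (λ p → toℕ (χ (u ⊕ p) ((u ⊕ v) ⊕ r)))) ∎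
    where
    Φ : Word n → Word n → ℕ
    Φ p t = toℕ (χ (u ⊕ p) ((u ⊕ v) ⊕ t))
    term : ∀ p q → (weight (p ++ q) ≡ᵇ 2) ⊙ 𝟙[ colouring ((u ++ v) ⊕ (p ++ q)) ≟ fs fz ]
                 ≡ (weight p + weight q ≡ᵇ 2) ⊙ Φ p (p ⊕ q)
    term p q rewrite weight-++ p q | zipWith-++ _xor_ u v p q | colouring-++ (u ⊕ p) (v ⊕ q)
                   | ⊕-interchange u p v q = cong ((weight p + weight q ≡ᵇ 2) ⊙_) (𝟙[toFin≟1] _)

module FaceLift {n s k} (col : Colouring n) (F : Fin k → Face n s)
  (cover : ∀ x → IsVertex x → (col x ≡ fs fz ⇔ ∃ λ i → x ∈F F i))
  (disjoint : ∀ i j x → x ∈F F i → x ∈F F j → i ≡ j) where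

  free : Fin k → Word n
  free i = Face.free (F i)

  χ : Word n → Word n → Bool
  χ u z = anyFin k (λ i → memberᵇ (F i) z ∧ parity (u ∖ free i))

  open Lift χ public

  ∈face⇒cell1 : ∀ x i → x ∈F F i → col x ≡ fs fz
  ∈face⇒cell1 x i x∈F = Equivalence.from (cover x (proj₁ x∈F)) (i , x∈F)

  cell1⇒∈face : ∀ x → IsVertex x → col x ≡ fs fz → ∃ λ i → x ∈F F i
  cell1⇒∈face x v = Equivalence.to (cover x v)

  χ-cell0 : ∀ u z → col z ≡ fz → χ u z ≡ false
  χ-cell0 u z z∈C₀ = anyFin-false k _ not-in
    where
    not-in : ∀ i → memberᵇ (F i) z ∧ parity (u ∖ free i) ≡ false
    not-in i with memberᵇ (F i) z in z∈Fi
    ... | false = refl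
    ... | true with () ← trans (sym z∈C₀) (∈face⇒cell1 z i (memberᵇ-sound (F i) z z∈Fi))

  χ-face : ∀ u z i → z ∈F F i → χ u z ≡ parity (u ∖ free i)
  χ-face u z i z∈Fi =
    trans (anyFin-unique k _ i only-i) (cong (_∧ parity (u ∖ free i)) (memberᵇ-complete (F i) z z∈Fi))
    where
    only-i : ∀ j → memberᵇ (F j) z ∧ parity (u ∖ free j) ≡ true → j ≡ i
    only-i j e = disjoint j i z (memberᵇ-sound (F j) z (proj₁ (∧-true e))) z∈Fi

  ∈face-⊕ : ∀ z r i → weight r ≡ 2 → r ⊆ᵇ free i ≡ true → z ∈F F i → (z ⊕ r) ∈F F i
  ∈face-⊕ z r i w r⊆T z∈Fi =
    memberᵇ-sound (F i) (z ⊕ r) (trans (memberᵇ-⊕ (F i) z r (weight2⇒even r w) r⊆T) (memberᵇ-complete (F i) z z∈Fi))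

  ∈face-⊕⁻ : ∀ z r i → weight r ≡ 2 → r ⊆ᵇ free i ≡ true → (z ⊕ r) ∈F F i → z ∈F F i
  ∈face-⊕⁻ z r i w r⊆T z⊕r∈Fi =
    memberᵇ-sound (F i) z (trans (sym (memberᵇ-⊕ (F i) z r (weight2⇒even r w) r⊆T)) (memberᵇ-complete (F i) (z ⊕ r) z⊕r∈Fi))

  moveBy : Word n → Word n → Word n → ℕ
  moveBy u z r = ∑⊆ r (λ p → toℕ (χ (u ⊕ p) (z ⊕ r)))

  moveBy-cell0 : ∀ u z r → col (z ⊕ r) ≡ fz → moveBy u z r ≡ 0
  moveBy-cell0 u z r e =
    trans (∑-cong (λ p → trans (cong (λ x → (p ⊆ᵇ r) ⊙ toℕ x) (χ-cell0 (u ⊕ p) (z ⊕ r) e)) (⊙-zeroʳ (p ⊆ᵇ r))))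
          (∑-zero n)

  moveBy-face : ∀ u z r i → (z ⊕ r) ∈F F i → moveBy u z r ≡ oddCount (free i) r (parity (u ∖ free i))
  moveBy-face u z r i z⊕r∈Fi = ∑-cong (λ p → cong (λ x → (p ⊆ᵇ r) ⊙ toℕ x)
    (trans (χ-face (u ⊕ p) (z ⊕ r) i z⊕r∈Fi) (parity-∖-⊕ u p (free i))))

  moveBy-transverse : ∀ u z r → IsVertex z → weight r ≡ 2 → (∀ i → z ∈F F i → r ⊆ᵇ free i ≡ false) →
    moveBy u z r ≡ 2 * 𝟙[ col (z ⊕ r) ≟ fs fz ]
  moveBy-transverse u z r v w transverse with col (z ⊕ r) in e
  ... | fz = moveBy-cell0 u z r e
  ... | fs fz with cell1⇒∈face (z ⊕ r) (IsVertex-⊕ z r v (weight2⇒even r w)) e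
  ...   | i , z⊕r∈Fi with r ⊆ᵇ free i in r⊆T
  ...     | false = trans (moveBy-face u z r i z⊕r∈Fi) (oddCount-pair (free i) r (parity (u ∖ free i)) w r⊆T)
  ...     | true with () ← trans (sym r⊆T) (transverse i (∈face-⊕⁻ z r i w r⊆T z⊕r∈Fi))

  moveBy-along : ∀ u z r i → z ∈F F i → weight r ≡ 2 → r ⊆ᵇ free i ≡ true →
    moveBy u z r ≡ 4 * toℕ (parity (u ∖ free i))
  moveBy-along u z r i z∈Fi w r⊆T = begin
    moveBy u z r                                   ≡⟨ moveBy-face u z r i (∈face-⊕ z r i w r⊆T z∈Fi) ⟩
    oddCount (free i) r (parity (u ∖ free i))      ≡⟨ oddCount-⊆ (free i) r _ r⊆T ⟩
    2 ^ weight r * toℕ (parity (u ∖ free i))       ≡⟨ cong (λ t → 2 ^ t * toℕ (parity (u ∖ free i))) w ⟩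
    4 * toℕ (parity (u ∖ free i))                  ∎

  module Counting {a b c d} (equitable : IsEquitable col (mat2 a b c d)) (hs : s * s + 2 * b ≡ 2 * d + n) where

    cell1-count : ∀ z → IsVertex z → ∑ʷ 2 (λ r → 𝟙[ col (z ⊕ r) ≟ fs fz ]) ≡ mat2 a b c d (col z) (fs fz)
    cell1-count z v = trans (sym (nbrCount-translates col z (IsVertex⇒even z v) (fs fz))) (proj₂ equitable z v (fs fz))

    row-sum : ∀ i → mat2 a b c d i fz + mat2 a b c d i (fs fz) ≡ weight2-count n
    row-sum i with proj₁ equitable i
    ... | x , v , refl =
      trans (sym (cong₂ _+_ (proj₂ equitable x v fz) (proj₂ equitable x v (fs fz)))) (degree col x (IsVertex⇒even x v))

    stay : Word n → Word n → ℕ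
    stay u z = ∑ʷ 1 (λ p → toℕ (χ (u ⊕ p) z))

    move : Word n → Word n → ℕ
    move u z = ∑ʷ 2 (moveBy u z)

    stay-cell0 : ∀ u z → col z ≡ fz → stay u z ≡ 0
    stay-cell0 u z z∈C₀ = trans (∑ʷ-cong 1 (λ p _ → cong toℕ (χ-cell0 (u ⊕ p) z z∈C₀))) (trans (∑-cong {n} (λ p → ⊙-zeroʳ (weight p ≡ᵇ 1))) (∑-zero n))

    move-cell0 : ∀ u z → IsVertex z → col z ≡ fz → move u z ≡ 2 * b
    move-cell0 u z v z∈C₀ = begin
      move u z                                       ≡⟨ ∑ʷ-cong 2 (λ r w → moveBy-transverse u z r v w (not-in-face r)) ⟩
      ∑ʷ 2 (λ r → 2 * 𝟙[ col (z ⊕ r) ≟ fs fz ])   ≡⟨ ∑ʷ-* 2 2 (λ r → 𝟙[ col (z ⊕ r) ≟ fs fz ]) ⟩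
      2 * ∑ʷ 2 (λ r → 𝟙[ col (z ⊕ r) ≟ fs fz ])   ≡⟨ cong (2 *_) (cell1-count z v) ⟩
      2 * mat2 a b c d (col z) (fs fz)            ≡⟨ cong (λ i → 2 * mat2 a b c d i (fs fz)) z∈C₀ ⟩
      2 * b                                       ∎
      where
      not-in-face : ∀ r i → z ∈F F i → r ⊆ᵇ free i ≡ false
      not-in-face r i z∈Fi with () ← trans (sym z∈C₀) (∈face⇒cell1 z i z∈Fi)

    module _ (u z : Word n) (i : Fin k) (z∈Fi : z ∈F F i) where

      private
        g : Bool
        g = parity (u ∖ free i)

      stay-face : stay u z ≡ ∑ʷ 1 (λ p → toℕ (g xor not (p ⊆ᵇ free i)))
      stay-face = ∑ʷ-cong 1 (λ p w → cong toℕ (begin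
        χ (u ⊕ p) z                    ≡⟨ χ-face (u ⊕ p) z i z∈Fi ⟩
        parity ((u ⊕ p) ∖ free i)      ≡⟨ parity-∖-⊕ u p (free i) ⟩
        g xor parity (p ∖ free i)      ≡⟨ cong (g xor_) (weight1⇒parity-∖ p (free i) w) ⟩
        g xor not (p ⊆ᵇ free i)        ∎))

      free-singles : ∑ʷ 1 (λ p → toℕ (p ⊆ᵇ free i)) ≡ s
      free-singles = trans (subsets-of-weight (free i) 1) (trans (cong (_C 1) (Face.nfree (F i))) (nC1≡n s))

      stay-odd : g ≡ true → stay u z ≡ s
      stay-odd odd = trans stay-face (trans (∑ʷ-cong 1 (λ p _ → cong toℕ (trans (cong (_xor not (p ⊆ᵇ free i)) odd) (not-involutive _))))
                                      free-singles)

      stay-even : g ≡ false → stay u z + s ≡ n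
      stay-even even = begin
        stay u z + s
          ≡⟨ cong₂ _+_ stay-face (sym free-singles) ⟩
        ∑ʷ 1 (λ p → toℕ (g xor not (p ⊆ᵇ free i))) + ∑ʷ 1 (λ p → toℕ (p ⊆ᵇ free i))
          ≡⟨ ∑ʷ-+ 1 (λ p → toℕ (g xor not (p ⊆ᵇ free i))) (λ p → toℕ (p ⊆ᵇ free i)) ⟨
        ∑ʷ 1 (λ p → toℕ (g xor not (p ⊆ᵇ free i)) + toℕ (p ⊆ᵇ free i))
          ≡⟨ ∑ʷ-cong 1 (λ p _ → trans (cong (λ h → toℕ (h xor not (p ⊆ᵇ free i)) + toℕ (p ⊆ᵇ free i)) even) (one-of (p ⊆ᵇ free i))) ⟩
        ∑ʷ {n} 1 (λ _ → 1)
          ≡⟨ trans (words-of-weight n 1) (nC1≡n n) ⟩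
        n ∎
        where
        one-of : ∀ x → toℕ (not x) + toℕ x ≡ 1
        one-of true  = refl
        one-of false = refl

      z∈C₁ : col z ≡ fs fz
      z∈C₁ = ∈face⇒cell1 z i z∈Fi

      moveBy-in-face : ∀ r → weight r ≡ 2 →
        moveBy u z r + 2 * toℕ (r ⊆ᵇ free i) ≡ 2 * 𝟙[ col (z ⊕ r) ≟ fs fz ] + 4 * toℕ g * toℕ (r ⊆ᵇ free i)
      moveBy-in-face r w with r ⊆ᵇ free i in r⊆T
      ... | true rewrite moveBy-along u z r i z∈Fi w r⊆T | ∈face⇒cell1 (z ⊕ r) i (∈face-⊕ z r i w r⊆T z∈Fi) =
        swap (toℕ g)
        where
        swap : ∀ x → 4 * x + 2 * 1 ≡ 2 * 1 + 4 * x * 1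
        swap = solve-∀
      ... | false = begin
        moveBy u z r + 0                              ≡⟨ +-identityʳ _ ⟩
        moveBy u z r                                  ≡⟨ moveBy-transverse u z r (proj₁ z∈Fi) w transverse ⟩
        2 * 𝟙[ col (z ⊕ r) ≟ fs fz ]                 ≡⟨ +-identityʳ _ ⟨
        2 * 𝟙[ col (z ⊕ r) ≟ fs fz ] + 0             ≡⟨ cong (2 * 𝟙[ col (z ⊕ r) ≟ fs fz ] +_) (*-zeroʳ (4 * toℕ g)) ⟨
        2 * 𝟙[ col (z ⊕ r) ≟ fs fz ] + 4 * toℕ g * 0 ∎
        where
        transverse : ∀ j → z ∈F F j → r ⊆ᵇ free j ≡ false
        transverse j z∈Fj with refl ← disjoint j i z z∈Fj z∈Fi = r⊆T

      move-face : move u z + 2 * (s C 2) ≡ 2 * d + 4 * toℕ g * (s C 2)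
      move-face = begin
        move u z + 2 * (s C 2)
          ≡⟨ cong (λ t → move u z + 2 * t) free-pairs ⟨
        move u z + 2 * ∑ʷ 2 (λ r → toℕ (r ⊆ᵇ free i))
          ≡⟨ cong (move u z +_) (∑ʷ-* 2 2 (λ r → toℕ (r ⊆ᵇ free i))) ⟨
        move u z + ∑ʷ 2 (λ r → 2 * toℕ (r ⊆ᵇ free i))
          ≡⟨ ∑ʷ-+ 2 (moveBy u z) (λ r → 2 * toℕ (r ⊆ᵇ free i)) ⟨
        ∑ʷ 2 (λ r → moveBy u z r + 2 * toℕ (r ⊆ᵇ free i))
          ≡⟨ ∑ʷ-cong 2 moveBy-in-face ⟩
        ∑ʷ 2 (λ r → 2 * 𝟙[ col (z ⊕ r) ≟ fs fz ] + 4 * toℕ g * toℕ (r ⊆ᵇ free i))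
          ≡⟨ ∑ʷ-+ 2 (λ r → 2 * 𝟙[ col (z ⊕ r) ≟ fs fz ]) (λ r → 4 * toℕ g * toℕ (r ⊆ᵇ free i)) ⟩
        ∑ʷ 2 (λ r → 2 * 𝟙[ col (z ⊕ r) ≟ fs fz ]) + ∑ʷ 2 (λ r → 4 * toℕ g * toℕ (r ⊆ᵇ free i))
          ≡⟨ cong₂ _+_ (∑ʷ-* 2 2 (λ r → 𝟙[ col (z ⊕ r) ≟ fs fz ])) (∑ʷ-* 2 (4 * toℕ g) (λ r → toℕ (r ⊆ᵇ free i))) ⟩
        2 * ∑ʷ 2 (λ r → 𝟙[ col (z ⊕ r) ≟ fs fz ]) + 4 * toℕ g * ∑ʷ 2 (λ r → toℕ (r ⊆ᵇ free i))
          ≡⟨ cong₂ (λ x y → 2 * x + 4 * toℕ g * y) (trans (cell1-count z (proj₁ z∈Fi)) (cong (λ j → mat2 a b c d j (fs fz)) z∈C₁)) free-pairs ⟩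
        2 * d + 4 * toℕ g * (s C 2) ∎
        where
        free-pairs : ∑ʷ 2 (λ r → toℕ (r ⊆ᵇ free i)) ≡ s C 2
        free-pairs = trans (subsets-of-weight (free i) 2) (cong (_C 2) (Face.nfree (F i)))

    lifted-rows : ∀ u v → parity (u ++ v) ≡ false →
      ∀ j → nbrCount colouring (u ++ v) j ≡ lifted n a b c d (colouring (u ++ v)) j
    lifted-rows u v even = subst (λ x → ∀ j → N j ≡ lifted n a b c d x j) (sym (colouring-++ u v)) (by-cell (col z) refl)
      where
      z : Word n
      z = u ⊕ v
      N : Fin 2 → ℕ
      N = nbrCount colouring (u ++ v)
      z-vertex : IsVertex z
      z-vertex = even⇒IsVertex z (trans (parity-⊕ u v) (trans (sym (parity-++ u v)) even))
      total : N fz + N (fs fz) ≡ n + 4 * weight2-count n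
      total = trans (degree colouring (u ++ v) even) (weight2-count-+ n)
      N₁ : N (fs fz) ≡ stay u z + move u z
      N₁ = nbrCount-++ u v even
      by-cell : ∀ x → col z ≡ x → ∀ j → N j ≡ lifted n a b c d (toFin (χ u z)) j
      by-cell fz z∈C₀ rewrite χ-cell0 u z z∈C₀ =
        row₀ n a b c d N (row-sum fz) total (trans N₁ (cong₂ _+_ (stay-cell0 u z z∈C₀) (move-cell0 u z z-vertex z∈C₀)))
      by-cell (fs fz) z∈C₁ with cell1⇒∈face z z-vertex z∈C₁
      ... | i , z∈Fi rewrite χ-face u z i z∈Fi with parity (u ∖ free i) in g
      ...   | true  = row₁ n a b c d N (row-sum (fs fz)) total (trans (cong (_+ 2 * b) N₁)
              (odd-case-count {stay u z} {move u z} {s} {s C 2} {b} {d} {n} (stay-odd u z i z∈Fi g) (trans (move-face u z i z∈Fi) (cong (λ x → 2 * d + 4 * toℕ x * (s C 2)) g))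
                              (2*nC2+n≡n*n s) hs))
      ...   | false = row₀ n a b c d N (row-sum fz) total (trans N₁
              (even-case-count {stay u z} {move u z} {s} {s C 2} {b} {d} {n} (stay-even u z i z∈Fi g)
                               (trans (move-face u z i z∈Fi) (trans (cong (λ x → 2 * d + 4 * toℕ x * (s C 2)) g) (+-identityʳ _)))
                               (2*nC2+n≡n*n s) hs))

    lifted-nonempty : ∀ j → ∃ λ y → IsVertex y × colouring y ≡ j
    lifted-nonempty fz with x₀ , v₀ , x₀∈C₀ ← proj₁ equitable fz =
      x₀ ++ zeros , even⇒IsVertex (x₀ ++ zeros) even , colour
      where
      even : parity (x₀ ++ zeros) ≡ false
      even = trans (parity-++ x₀ zeros) (cong₂ _xor_ (IsVertex⇒even x₀ v₀) (parity-zeros n))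
      colour : colouring (x₀ ++ zeros) ≡ fz
      colour rewrite colouring-++ x₀ zeros | ⊕-identityʳ x₀ | χ-cell0 x₀ x₀ x₀∈C₀ = refl
    lifted-nonempty (fs fz) with proj₁ equitable fz | proj₁ equitable (fs fz)
    ... | x₀ , v₀ , x₀∈C₀ | x₁ , v₁ , x₁∈C₁ with i , x₁∈Fi ← cell1⇒∈face x₁ v₁ x₁∈C₁ with ≡-dec _≟ᵇ_ (free i) ones
    ...   | yes all-free with () ← trans (sym x₀∈C₀) (∈face⇒cell1 x₀ i (all-free⇒∈F (F i) x₀ all-free v₀))
    ...   | no not-all-free with u , odd ← odd-off (free i) not-all-free =
      u ++ (u ⊕ x₁) , even⇒IsVertex (u ++ (u ⊕ x₁)) even , colour
      where
      even : parity (u ++ (u ⊕ x₁)) ≡ false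
      even = begin
        parity (u ++ (u ⊕ x₁))             ≡⟨ parity-++ u (u ⊕ x₁) ⟩
        parity u xor parity (u ⊕ x₁)       ≡⟨ parity-⊕ u (u ⊕ x₁) ⟨
        parity (u ⊕ (u ⊕ x₁))              ≡⟨ cong parity (⊕-cancelˡ u x₁) ⟩
        parity x₁                          ≡⟨ IsVertex⇒even x₁ v₁ ⟩
        false                              ∎
      colour : colouring (u ++ (u ⊕ x₁)) ≡ fs fz
      colour rewrite colouring-++ u (u ⊕ x₁) | ⊕-cancelˡ u x₁ | χ-face u x₁ i x₁∈Fi | odd = refl

    lifted-equitable : IsEquitable colouring (lifted n a b c d)
    lifted-equitable = lifted-nonempty , rows
      where
      rows : ∀ y → IsVertex y → ∀ j → nbrCount colouring y j ≡ lifted n a b c d (colouring y) j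
      rows y v j = subst (λ t → nbrCount colouring t j ≡ lifted n a b c d (colouring t) j) (take++drop≡id n y)
        (lifted-rows (take n y) (drop n y) (trans (cong parity (take++drop≡id n y)) (IsVertex⇒even y v)) j)

theorem3 : (n a b c d s : ℕ) (col : Colouring n) →
    IsEquitable col (mat2 a b c d) →
    s * s + 2 * b ≡ 2 * d + n →
    PartitionedIntoFaces col s →
    ∃ λ (col′ : Colouring (2 * n)) →
      IsEquitable col′
        (mat2 (4 * a + n + 2 * b) (2 * b) (4 * c + 2 * b) (4 * d + n ∸ 2 * b))
theorem3 n a b c d s col equitable hs (k , F , cover , disjoint) =
  subst (λ m → ∃ λ (col′ : Colouring (n + m)) → IsEquitable col′ (lifted n a b c d)) (sym (+-identityʳ n))
    (colouring , lifted-equitable)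
  where open FaceLift col F cover disjoint
        open Counting equitable hs
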